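{- Let $G$ be a connected, non-complete graph of order $n$ with $NC(G)\ge\frac{n-2}{2}$. Let $u$ be a vertex with $d_G(u)=\delta(G)$ and let $W=V(G)\setminus(N_G(u)\cup\{u\})$. For any $S\subset W$ with $|S|<\frac{n+2}{4}-\delta(G)$, the induced subgraph $G[W\setminus S]$ has at most two components.
   Context: All graphs are finite and simple. $\delta(G)$ is the minimum degree and $d_G(x)$ the degree of $x$; $N_G(x)$ is the neighbourhood of $x$; $G[X]$ is the subgraph induced by $X$. For a non-complete graph $G$, $NC(G)=\min\{|N_G(x)\cup N_G(y)| : x,y\in V(G),\ x\ne y,\ xy\notin E(G)\}$. -}

module Defs where

open import Data.Nat using (ℕ; _≤_)
open import Data.Bool using (Bool; true; false)
open import Data.Fin using (Fin)
open import Data.Fin.Subset using (Subset; _∈_; ∣_∣; _∪_; _─_; ∁; ⁅_⁆; ⊤)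
open import Data.Vec using (tabulate)
open import Data.Product using (Σ; _×_; ∃; ∃-syntax)
open import Data.Sum using (_⊎_)
open import Relation.Binary.PropositionalEquality using (_≡_; _≢_)

record Graph (n : ℕ) : Set where
  field
    adj   : Fin n → Fin n → Bool
    sym   : ∀ x y → adj x y ≡ adj y x
    irrefl : ∀ x → adj x x ≡ false

open Graph public

module _ {n : ℕ} (G : Graph n) where

  Adj : Fin n → Fin n → Set
  Adj x y = adj G x y ≡ true

  N : Fin n → Subset n
  N x = tabulate (λ y → adj G x y)

  deg : Fin n → ℕ
  deg x = ∣ N x ∣

  IsMinDegree : Fin n → Set
  IsMinDegree u = ∀ v → deg u ≤ deg v

  NonComplete : Set
  NonComplete = Σ (Fin n) λ x → Σ (Fin n) λ y → x ≢ y × adj G x y ≡ false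

  data Reach (X : Subset n) : Fin n → Fin n → Set where
    here : ∀ {x} → x ∈ X → Reach X x x
    step : ∀ {x y z} → x ∈ X → Adj x y → Reach X y z → Reach X x z

  Connected : Set
  Connected = ∀ x y → Reach ⊤ x y

  AtMostTwoComponents : Subset n → Set
  AtMostTwoComponents X =
    ∀ a b c → a ∈ X → b ∈ X → c ∈ X →
      Reach X a b ⊎ Reach X b c ⊎ Reach X a c

-- Suppose a, b, c ∈ W ∖ S lie in three different components of G[W ∖ S].
-- The sets N[x] ∪ N(u), x ∈ {a, b, c}, then pairwise meet only inside
-- N(u) ∪ S, since a common vertex outside it would lie in W ∖ S and join two
-- of a, b, c; and none of them contains u. Inclusion–exclusion therefore
-- gives Σₓ (|N(x) ∪ N(u)| + 1) ≤ n − 1 + 2(|S| + δ), whereas NC(G) ≥ (n − 2)/2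
-- makes each summand at least n/2. Together, n + 2 ≤ 4(|S| + δ).
module Submission where

open import Defs
open import Data.Nat using (ℕ; suc; z≤n; _+_; _*_; _≤_; _<_)
open import Data.Nat.Properties
  using ( +-suc; +-assoc; +-identityʳ; +-mono-≤; +-monoˡ-≤; +-monoʳ-≤; +-monoˡ-<; +-monoʳ-<; *-monoʳ-≤
        ; <-irrefl; module ≤-Reasoning)
open import Data.Nat.Tactic.RingSolver using (solve-∀)
open import Data.Bool using (false)
open import Data.Bool.Properties using (¬-not)
open import Data.Fin using (Fin)
open import Data.Fin.Subset
  using (Subset; inside; outside; _∈_; _∉_; _⊆_; _∪_; _∩_; _─_; ∁; ⁅_⁆; ∣_∣; Nonempty; Empty)
open import Data.Fin.Subset.Properties
  using ( _∈?_; nonempty?; Empty-unique; ∣⊥∣≡0; ∣⊤∣≡n; ∣⁅x⁆∣≡1; ⊆⊤; ∈⊤; p⊆q⇒∣p∣≤∣q∣; p⊂q⇒∣p∣<∣q∣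
        ; x∈⁅x⁆; x∈⁅y⁆⇒x≡y; x∈∁p⇒x∉p; x∉p⇒x∈∁p; x∈p∪q⁻; x∈p∪q⁺; x∈p∩q⁻; x∈p∩q⁺
        ; ∪-assoc; p─q⊆p; x∈p∧x∉q⇒x∈p─q)
open import Data.Vec using ([]; _∷_; here; there)
open import Data.Vec.Properties using (lookup∘tabulate; []=⇒lookup; lookup⇒[]=)
open import Data.Product using (_,_; proj₁; proj₂)
open import Data.Sum using (_⊎_; inj₁; inj₂; [_,_]′)
open import Data.Empty using (⊥; ⊥-elim)
open import Function using (_∘_; id)
open import Relation.Nullary using (yes; no; contradiction)
open import Relation.Nullary.Decidable using (decidable-stable)
open import Relation.Binary.PropositionalEquality as ≡
  using (_≡_; _≢_; refl; cong; cong₂; trans; subst; module ≡-Reasoning)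

∣p∪q∣+∣p∩q∣≡∣p∣+∣q∣ : ∀ {n} (p q : Subset n) → ∣ p ∪ q ∣ + ∣ p ∩ q ∣ ≡ ∣ p ∣ + ∣ q ∣
∣p∪q∣+∣p∩q∣≡∣p∣+∣q∣ []            []            = refl
∣p∪q∣+∣p∩q∣≡∣p∣+∣q∣ (outside ∷ p) (outside ∷ q) = ∣p∪q∣+∣p∩q∣≡∣p∣+∣q∣ p q
∣p∪q∣+∣p∩q∣≡∣p∣+∣q∣ (outside ∷ p) (inside  ∷ q) =
  trans (cong suc (∣p∪q∣+∣p∩q∣≡∣p∣+∣q∣ p q)) (≡.sym (+-suc (∣ p ∣) (∣ q ∣)))
∣p∪q∣+∣p∩q∣≡∣p∣+∣q∣ (inside  ∷ p) (outside ∷ q) = cong suc (∣p∪q∣+∣p∩q∣≡∣p∣+∣q∣ p q)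
∣p∪q∣+∣p∩q∣≡∣p∣+∣q∣ (inside  ∷ p) (inside  ∷ q) = cong suc (begin
  ∣ p ∪ q ∣ + suc ∣ p ∩ q ∣  ≡⟨ +-suc (∣ p ∪ q ∣) (∣ p ∩ q ∣) ⟩
  suc (∣ p ∪ q ∣ + ∣ p ∩ q ∣) ≡⟨ cong suc (∣p∪q∣+∣p∩q∣≡∣p∣+∣q∣ p q) ⟩
  suc (∣ p ∣ + ∣ q ∣)         ≡⟨ +-suc (∣ p ∣) (∣ q ∣) ⟨
  ∣ p ∣ + suc ∣ q ∣           ∎)
  where open ≡-Reasoning

∣p∪q∣≡∣p∣+∣q∣ : ∀ {n} (p q : Subset n) → Empty (p ∩ q) → ∣ p ∪ q ∣ ≡ ∣ p ∣ + ∣ q ∣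
∣p∪q∣≡∣p∣+∣q∣ {n} p q p∩q≡∅ = begin
  ∣ p ∪ q ∣                ≡⟨ +-identityʳ ∣ p ∪ q ∣ ⟨
  ∣ p ∪ q ∣ + 0            ≡⟨ cong (∣ p ∪ q ∣ +_) (trans (cong ∣_∣ (Empty-unique p∩q≡∅)) (∣⊥∣≡0 n)) ⟨
  ∣ p ∪ q ∣ + ∣ p ∩ q ∣    ≡⟨ ∣p∪q∣+∣p∩q∣≡∣p∣+∣q∣ p q ⟩
  ∣ p ∣ + ∣ q ∣            ∎
  where open ≡-Reasoning

x∉p⇒∣p∣<n : ∀ {n} {x : Fin n} {p : Subset n} → x ∉ p → ∣ p ∣ < n
x∉p⇒∣p∣<n {n} {x} {p} x∉p = subst (∣ p ∣ <_) (∣⊤∣≡n n) (p⊂q⇒∣p∣<∣q∣ (⊆⊤ , x , ∈⊤ , x∉p))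

x∉p∧x∉q⇒x∉p∪q : ∀ {n} {x : Fin n} {p q : Subset n} → x ∉ p → x ∉ q → x ∉ p ∪ q
x∉p∧x∉q⇒x∉p∪q {p = p} {q} x∉p x∉q = [ x∉p , x∉q ]′ ∘ x∈p∪q⁻ p q

x∉p⇒∣⁅x⁆∪p∣≡1+∣p∣ : ∀ {n} {x : Fin n} {p : Subset n} → x ∉ p → ∣ ⁅ x ⁆ ∪ p ∣ ≡ suc ∣ p ∣
x∉p⇒∣⁅x⁆∪p∣≡1+∣p∣ {x = x} {p} x∉p =
  trans (∣p∪q∣≡∣p∣+∣q∣ ⁅ x ⁆ p ⁅x⁆∩p≡∅) (cong (_+ ∣ p ∣) (∣⁅x⁆∣≡1 x))
  where
  ⁅x⁆∩p≡∅ : Empty (⁅ x ⁆ ∩ p)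
  ⁅x⁆∩p≡∅ (y , y∈⁅x⁆∩p) with x∈p∩q⁻ ⁅ x ⁆ p y∈⁅x⁆∩p
  ... | y∈⁅x⁆ , y∈p with refl ← x∈⁅y⁆⇒x≡y x y∈⁅x⁆ = x∉p y∈p

x∈p∪q∧x∉q⇒x∈p : ∀ {n} {x : Fin n} (p q : Subset n) → x ∈ p ∪ q → x ∉ q → x ∈ p
x∈p∪q∧x∉q⇒x∈p p q x∈p∪q x∉q = [ id , (λ x∈q → contradiction x∈q x∉q) ]′ (x∈p∪q⁻ p q x∈p∪q)

x∈p─q⇒x∉q : ∀ {n} {x : Fin n} (p q : Subset n) → x ∈ p ─ q → x ∉ q
x∈p─q⇒x∉q (inside ∷ p) (outside ∷ q) here ()
x∈p─q⇒x∉q (_ ∷ p)      (_ ∷ q)       (there x∈p─q) (there x∈q) = x∈p─q⇒x∉q p q x∈p─q x∈q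

p⊆q⊎p─q≢∅ : ∀ {n} (p q : Subset n) → p ⊆ q ⊎ Nonempty (p ─ q)
p⊆q⊎p─q≢∅ p q with nonempty? (p ─ q)
... | yes p─q≢∅ = inj₂ p─q≢∅
... | no  p─q≡∅ = inj₁ λ {x} x∈p →
  decidable-stable (x ∈? q) (λ x∉q → p─q≡∅ (x , x∈p∧x∉q⇒x∈p─q x∈p x∉q))

∣p∣+∣q∣+∣r∣≤∣p∪q∪r∣+2∣t∣ : ∀ {n} (p q r t : Subset n) →
  p ∩ q ⊆ t → p ∩ r ⊆ t → q ∩ r ⊆ t →
  ∣ p ∣ + ∣ q ∣ + ∣ r ∣ ≤ ∣ p ∪ q ∪ r ∣ + 2 * ∣ t ∣
∣p∣+∣q∣+∣r∣≤∣p∪q∪r∣+2∣t∣ p q r t p∩q⊆t p∩r⊆t q∩r⊆t = begin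
  ∣ p ∣ + ∣ q ∣ + ∣ r ∣
    ≡⟨ +-assoc (∣ p ∣) (∣ q ∣) (∣ r ∣) ⟩
  ∣ p ∣ + (∣ q ∣ + ∣ r ∣)
    ≡⟨ cong (∣ p ∣ +_) (∣p∪q∣+∣p∩q∣≡∣p∣+∣q∣ q r) ⟨
  ∣ p ∣ + (∣ q ∪ r ∣ + ∣ q ∩ r ∣)
    ≡⟨ +-assoc (∣ p ∣) (∣ q ∪ r ∣) (∣ q ∩ r ∣) ⟨
  ∣ p ∣ + ∣ q ∪ r ∣ + ∣ q ∩ r ∣
    ≡⟨ cong (_+ ∣ q ∩ r ∣) (∣p∪q∣+∣p∩q∣≡∣p∣+∣q∣ p (q ∪ r)) ⟨
  ∣ p ∪ q ∪ r ∣ + ∣ p ∩ (q ∪ r) ∣ + ∣ q ∩ r ∣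
    ≤⟨ +-mono-≤ (+-monoʳ-≤ ∣ p ∪ q ∪ r ∣ (p⊆q⇒∣p∣≤∣q∣ p∩[q∪r]⊆t)) (p⊆q⇒∣p∣≤∣q∣ q∩r⊆t) ⟩
  ∣ p ∪ q ∪ r ∣ + ∣ t ∣ + ∣ t ∣
    ≡⟨ double (∣ p ∪ q ∪ r ∣) (∣ t ∣) ⟩
  ∣ p ∪ q ∪ r ∣ + 2 * ∣ t ∣
    ∎
  where
  open ≤-Reasoning
  double : ∀ a b → a + b + b ≡ a + 2 * b
  double = solve-∀
  p∩[q∪r]⊆t : p ∩ (q ∪ r) ⊆ t
  p∩[q∪r]⊆t x∈ with x∈p∩q⁻ p (q ∪ r) x∈
  ... | x∈p , x∈q∪r =
    [ (λ x∈q → p∩q⊆t (x∈p∩q⁺ (x∈p , x∈q))) , (λ x∈r → p∩r⊆t (x∈p∩q⁺ (x∈p , x∈r))) ]′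
      (x∈p∪q⁻ q r x∈q∪r)

counting-absurd : ∀ {n A B C t} → n ≤ 2 * A + 2 → n ≤ 2 * B + 2 → n ≤ 2 * C + 2 →
  suc A + suc B + suc C < n + 2 * t → 4 * t < n + 2 → ⊥
counting-absurd {n} {A} {B} {C} {t} n≤2A+2 n≤2B+2 n≤2C+2 ΣA<n+2t 4t<n+2 = <-irrefl refl (begin-strict
  3 * n + 2
    ≤⟨ +-monoˡ-≤ 2 (+-mono-≤ n≤2A+2 (+-mono-≤ n≤2B+2 (+-mono-≤ n≤2C+2 z≤n))) ⟩
  (2 * A + 2) + ((2 * B + 2) + ((2 * C + 2) + 0)) + 2  ≡⟨ regroup A B C ⟩
  2 * suc (suc A + suc B + suc C)              ≤⟨ *-monoʳ-≤ 2 ΣA<n+2t ⟩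
  2 * (n + 2 * t)                              ≡⟨ distribute n t ⟩
  2 * n + 4 * t                                <⟨ +-monoʳ-< (2 * n) 4t<n+2 ⟩
  2 * n + (n + 2)                              ≡⟨ collect n ⟩
  3 * n + 2                                    ∎)
  where
  open ≤-Reasoning
  regroup : ∀ A B C →
    (2 * A + 2) + ((2 * B + 2) + ((2 * C + 2) + 0)) + 2 ≡ 2 * suc (suc A + suc B + suc C)
  regroup = solve-∀
  distribute : ∀ n t → 2 * (n + 2 * t) ≡ 2 * n + 4 * t
  distribute = solve-∀
  collect : ∀ n → 2 * n + (n + 2) ≡ 3 * n + 2
  collect = solve-∀

module _ {n : ℕ} (G : Graph n) where

  N[_] : Fin n → Subset n
  N[ x ] = ⁅ x ⁆ ∪ N G x

  ∈N⇒Adj : ∀ {x y} → y ∈ N G x → Adj G x y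
  ∈N⇒Adj {x} {y} y∈Nx = trans (≡.sym (lookup∘tabulate (adj G x) y)) ([]=⇒lookup y∈Nx)

  Adj⇒∈N : ∀ {x y} → Adj G x y → y ∈ N G x
  Adj⇒∈N {x} {y} xy = lookup⇒[]= y (N G x) (trans (lookup∘tabulate (adj G x) y) xy)

  Adj-sym : ∀ {x y} → Adj G x y → Adj G y x
  Adj-sym {x} {y} xy = trans (Graph.sym G y x) xy

  x∉Nx : ∀ x → x ∉ N G x
  x∉Nx x x∈Nx with () ← trans (≡.sym (∈N⇒Adj x∈Nx)) (irrefl G x)

  ∈N[]⇒≡⊎Adj : ∀ {x y} → y ∈ N[ x ] → y ≡ x ⊎ Adj G x y
  ∈N[]⇒≡⊎Adj {x} y∈N[x] = [ inj₁ ∘ x∈⁅y⁆⇒x≡y x , inj₂ ∘ ∈N⇒Adj ]′ (x∈p∪q⁻ ⁅ x ⁆ (N G x) y∈N[x])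

  common-closed-neighbour⇒Reach : ∀ {X x y i} → x ∈ X → y ∈ X → i ∈ X →
    i ∈ N[ x ] → i ∈ N[ y ] → Reach G X x y
  common-closed-neighbour⇒Reach {X} {x} {y} {i} x∈X y∈X i∈X i∈N[x] i∈N[y]
    with ∈N[]⇒≡⊎Adj i∈N[x] | ∈N[]⇒≡⊎Adj i∈N[y]
  ... | inj₁ refl | inj₁ refl = here x∈X
  ... | inj₁ refl | inj₂ yi   = step x∈X (Adj-sym yi) (here y∈X)
  ... | inj₂ xi   | inj₁ refl = step x∈X xi (here y∈X)
  ... | inj₂ xi   | inj₂ yi   = step x∈X xi (step i∈X (Adj-sym yi) (here y∈X))

  module _ (u : Fin n) (S : Subset n) where

    W X : Subset n
    W = ∁ (N G u ∪ ⁅ u ⁆)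
    X = W ─ S

    ∈W⇒∉Nu : ∀ {x} → x ∈ W → x ∉ N G u
    ∈W⇒∉Nu x∈W x∈Nu = x∈∁p⇒x∉p x∈W (x∈p∪q⁺ (inj₁ x∈Nu))

    ∈W⇒≢u : ∀ {x} → x ∈ W → x ≢ u
    ∈W⇒≢u x∈W refl = x∈∁p⇒x∉p x∈W (x∈p∪q⁺ (inj₂ (x∈⁅x⁆ u)))

    ∈W⇒u∉N : ∀ {x} → x ∈ W → u ∉ N G x
    ∈W⇒u∉N x∈W u∈Nx = ∈W⇒∉Nu x∈W (Adj⇒∈N (Adj-sym (∈N⇒Adj u∈Nx)))

    ∈W⇒u∉N[] : ∀ {x} → x ∈ W → u ∉ N[ x ]
    ∈W⇒u∉N[] {x} x∈W = x∉p∧x∉q⇒x∉p∪q (∈W⇒≢u x∈W ∘ ≡.sym ∘ x∈⁅y⁆⇒x≡y x) (∈W⇒u∉N x∈W)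

    ∈W⇒u∉N[]∪Nu : ∀ {x} → x ∈ W → u ∉ N[ x ] ∪ N G u
    ∈W⇒u∉N[]∪Nu x∈W = x∉p∧x∉q⇒x∉p∪q (∈W⇒u∉N[] x∈W) (x∉Nx u)

    ∈W⇒∣N[]∪Nu∣≡1+∣N∪Nu∣ : ∀ {x} → x ∈ W → ∣ N[ x ] ∪ N G u ∣ ≡ suc ∣ N G x ∪ N G u ∣
    ∈W⇒∣N[]∪Nu∣≡1+∣N∪Nu∣ {x} x∈W =
      trans (cong ∣_∣ (∪-assoc ⁅ x ⁆ (N G x) (N G u)))
            (x∉p⇒∣⁅x⁆∪p∣≡1+∣p∣ (x∉p∧x∉q⇒x∉p∪q (x∉Nx x) (∈W⇒∉Nu x∈W)))

    ∈W⇒adj-u≡false : ∀ {x} → x ∈ W → adj G x u ≡ false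
    ∈W⇒adj-u≡false x∈W = ¬-not (∈W⇒u∉N x∈W ∘ Adj⇒∈N)

    S⊆W⇒∣S∪Nu∣≡∣S∣+∣Nu∣ : S ⊆ W → ∣ S ∪ N G u ∣ ≡ ∣ S ∣ + deg G u
    S⊆W⇒∣S∪Nu∣≡∣S∣+∣Nu∣ S⊆W = ∣p∪q∣≡∣p∣+∣q∣ S (N G u) S∩Nu≡∅
      where
      S∩Nu≡∅ : Empty (S ∩ N G u)
      S∩Nu≡∅ (y , y∈S∩Nu) with x∈p∩q⁻ S (N G u) y∈S∩Nu
      ... | y∈S , y∈Nu = ∈W⇒∉Nu (S⊆W y∈S) y∈Nu

    ∈X⇒∈W : ∀ {x} → x ∈ X → x ∈ W
    ∈X⇒∈W = p─q⊆p W S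

    ∉S∪Nu⇒∈X : ∀ {x} → x ≢ u → x ∉ S ∪ N G u → x ∈ X
    ∉S∪Nu⇒∈X x≢u x∉S∪Nu = x∈p∧x∉q⇒x∈p─q
      (x∉p⇒x∈∁p (x∉p∧x∉q⇒x∉p∪q (x∉S∪Nu ∘ x∈p∪q⁺ ∘ inj₂) (x≢u ∘ x∈⁅y⁆⇒x≡y u)))
      (x∉S∪Nu ∘ x∈p∪q⁺ ∘ inj₁)

    overlap⇒Reach : ∀ {x y i} → x ∈ X → y ∈ X →
      i ∈ (N[ x ] ∪ N G u) ∩ (N[ y ] ∪ N G u) → i ∉ S ∪ N G u → Reach G X x y
    overlap⇒Reach {x} {y} {i} x∈X y∈X i∈∩ i∉S∪Nu =
      common-closed-neighbour⇒Reach x∈X y∈X (∉S∪Nu⇒∈X i≢u i∉S∪Nu) i∈N[x] i∈N[y]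
      where
      i∉Nu : i ∉ N G u
      i∉Nu = i∉S∪Nu ∘ x∈p∪q⁺ ∘ inj₂
      i∈N[x] : i ∈ N[ x ]
      i∈N[x] = x∈p∪q∧x∉q⇒x∈p N[ x ] (N G u) (proj₁ (x∈p∩q⁻ _ _ i∈∩)) i∉Nu
      i∈N[y] : i ∈ N[ y ]
      i∈N[y] = x∈p∪q∧x∉q⇒x∈p N[ y ] (N G u) (proj₂ (x∈p∩q⁻ _ _ i∈∩)) i∉Nu
      i≢u : i ≢ u
      i≢u refl = ∈W⇒u∉N[] (∈X⇒∈W x∈X) i∈N[x]

    overlap⊆S∪Nu⊎Reach : ∀ {x y} → x ∈ X → y ∈ X →
      (N[ x ] ∪ N G u) ∩ (N[ y ] ∪ N G u) ⊆ S ∪ N G u ⊎ Reach G X x y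
    overlap⊆S∪Nu⊎Reach x∈X y∈X with p⊆q⊎p─q≢∅ _ (S ∪ N G u)
    ... | inj₁ overlap⊆S∪Nu = inj₁ overlap⊆S∪Nu
    ... | inj₂ (i , i∈overlap─S∪Nu) =
      inj₂ (overlap⇒Reach x∈X y∈X (p─q⊆p _ _ i∈overlap─S∪Nu) (x∈p─q⇒x∉q _ _ i∈overlap─S∪Nu))

    ∑∣N∪Nu∣<n+2[∣S∣+∣Nu∣] : S ⊆ W → ∀ {a b c} → a ∈ W → b ∈ W → c ∈ W →
      (N[ a ] ∪ N G u) ∩ (N[ b ] ∪ N G u) ⊆ S ∪ N G u →
      (N[ a ] ∪ N G u) ∩ (N[ c ] ∪ N G u) ⊆ S ∪ N G u →
      (N[ b ] ∪ N G u) ∩ (N[ c ] ∪ N G u) ⊆ S ∪ N G u →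
      suc ∣ N G a ∪ N G u ∣ + suc ∣ N G b ∪ N G u ∣ + suc ∣ N G c ∪ N G u ∣ < n + 2 * (∣ S ∣ + deg G u)
    ∑∣N∪Nu∣<n+2[∣S∣+∣Nu∣] S⊆W {a} {b} {c} a∈W b∈W c∈W ab⊆ ac⊆ bc⊆ = begin-strict
      suc ∣ N G a ∪ N G u ∣ + suc ∣ N G b ∪ N G u ∣ + suc ∣ N G c ∪ N G u ∣
        ≡⟨ cong₂ _+_ (cong₂ _+_ (∈W⇒∣N[]∪Nu∣≡1+∣N∪Nu∣ a∈W) (∈W⇒∣N[]∪Nu∣≡1+∣N∪Nu∣ b∈W))
                     (∈W⇒∣N[]∪Nu∣≡1+∣N∪Nu∣ c∈W) ⟨
      ∣ N[ a ] ∪ N G u ∣ + ∣ N[ b ] ∪ N G u ∣ + ∣ N[ c ] ∪ N G u ∣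
        ≤⟨ ∣p∣+∣q∣+∣r∣≤∣p∪q∪r∣+2∣t∣ _ _ _ (S ∪ N G u) ab⊆ ac⊆ bc⊆ ⟩
      ∣ (N[ a ] ∪ N G u) ∪ (N[ b ] ∪ N G u) ∪ (N[ c ] ∪ N G u) ∣ + 2 * ∣ S ∪ N G u ∣
        <⟨ +-monoˡ-< _ (x∉p⇒∣p∣<n u∉⋃) ⟩
      n + 2 * ∣ S ∪ N G u ∣
        ≡⟨ cong (λ k → n + 2 * k) (S⊆W⇒∣S∪Nu∣≡∣S∣+∣Nu∣ S⊆W) ⟩
      n + 2 * (∣ S ∣ + deg G u) ∎
      where
      open ≤-Reasoning
      u∉⋃ : u ∉ (N[ a ] ∪ N G u) ∪ (N[ b ] ∪ N G u) ∪ (N[ c ] ∪ N G u)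
      u∉⋃ = x∉p∧x∉q⇒x∉p∪q (∈W⇒u∉N[]∪Nu a∈W) (x∉p∧x∉q⇒x∉p∪q (∈W⇒u∉N[]∪Nu b∈W) (∈W⇒u∉N[]∪Nu c∈W))

    atMostTwoComponents : S ⊆ W → (∀ {x} → x ∈ W → n ≤ 2 * ∣ N G x ∪ N G u ∣ + 2) →
      4 * (∣ S ∣ + deg G u) < n + 2 → AtMostTwoComponents G X
    atMostTwoComponents S⊆W nc-u 4[s+d]<n+2 a b c a∈X b∈X c∈X
      with overlap⊆S∪Nu⊎Reach a∈X b∈X | overlap⊆S∪Nu⊎Reach b∈X c∈X | overlap⊆S∪Nu⊎Reach a∈X c∈X
    ... | inj₂ a~b | _        | _        = inj₁ a~b
    ... | inj₁ _   | inj₂ b~c | _        = inj₂ (inj₁ b~c)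
    ... | inj₁ _   | inj₁ _   | inj₂ a~c = inj₂ (inj₂ a~c)
    ... | inj₁ ab⊆ | inj₁ bc⊆ | inj₁ ac⊆ = ⊥-elim
      (counting-absurd {t = ∣ S ∣ + deg G u} (nc-u a∈W) (nc-u b∈W) (nc-u c∈W)
        (∑∣N∪Nu∣<n+2[∣S∣+∣Nu∣] S⊆W a∈W b∈W c∈W ab⊆ ac⊆ bc⊆) 4[s+d]<n+2)
      where
      a∈W : a ∈ W
      a∈W = ∈X⇒∈W a∈X
      b∈W : b ∈ W
      b∈W = ∈X⇒∈W b∈X
      c∈W : c ∈ W
      c∈W = ∈X⇒∈W c∈X

lemma2p3 : (n : ℕ) (G : Graph n) →
    Connected G →
    NonComplete G →
    (∀ x y → x ≢ y → adj G x y ≡ false → n ≤ 2 * ∣ N G x ∪ N G y ∣ + 2) →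
    (u : Fin n) → IsMinDegree G u →
    (S : Subset n) →
    S ⊆ ∁ (N G u ∪ ⁅ u ⁆) →
    4 * (∣ S ∣ + deg G u) < n + 2 →
    AtMostTwoComponents G (∁ (N G u ∪ ⁅ u ⁆) ─ S)
lemma2p3 n G _ _ nc u _ S S⊆W =
  atMostTwoComponents G u S S⊆W λ x∈W → nc _ u (∈W⇒≢u G u S x∈W) (∈W⇒adj-u≡false G u S x∈W)
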